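{- Let $G$ be the geometric graph described in the context. If $ab$ and $cd$ are edges of $G$ such that (1) $a$ has larger $y$-coordinate than each of $b$, $c$, $d$, and (2) the $x$-coordinate of $b$ is either smaller than both $x$-coordinates of $c$ and $d$ or larger than both, then the segments $ab$ and $cd$ do not cross.
   Context: Let $H\ge 2$ and $n=2^H-1$. Let $B$ be a complete rooted ordered binary tree on $n$ vertices. A level is a set of vertices at the same distance from the root. The preorder traversal of $B$ (root, then recursively the left subtree, then recursively the right subtree) gives a total order on the vertices and on each level; two consecutive vertices of the same level in this order are level-neighbors (left and right level-neighbor). For a vertex $v$, $B(v)$ is the subtree of $B$ rooted at $v$. The graph $G$ consists of the edges of $B$ together with: (E1) every vertex $v$ is adjacent to all vertices of $B(v)$; (E2) every vertex $v$ with a left or right level-neighbor $u$ is adjacent to all vertices of $B(u)$; (E3) every vertex $v$ whose parent has a left level-neighbor $p$ is adjacent to all vertices of $B(p)$. Vertices are placed in the plane as follows: the $x$-coordinates are $0,\dots,n-1$ in preorder; the $y$-coordinates are distinct and ordered by a BFS traversal of $B$ from the root in which, at every vertex, the right child is visited before the left child: a vertex visited earlier gets a larger $y$-coordinate. Moreover, the $y$-coordinates are chosen so that every vertex lies strictly above every line through two vertices with smaller $y$-coordinates. Edges are straight-line segments.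
   Formalization: The y-coordinates of the vertices are rational instead of real. -}

module Defs where

open import Data.Bool using (Bool; true; false)
open import Data.Nat as ℕ using (ℕ; zero; suc; _^_)
open import Data.List using (List; []; _∷_; _++_; [_]; length)
open import Data.Product using (Σ; ∃; ∃-syntax; _×_; _,_; proj₁)
open import Data.Sum using (_⊎_)
open import Data.Integer using (+_)
open import Data.Rational using (ℚ; _/_; _+_; _*_; _-_; _<_; 0ℚ; 1ℚ)
open import Relation.Binary.PropositionalEquality using (_≡_; _≢_)

-- A vertex of the complete binary tree B with H levels is encoded by its
-- path from the root (false = go to left child, true = go to right child);
-- the depth of the vertex is the length of the path, which is < H.
Path : Set
Path = List Bool

Vertex : ℕ → Set
Vertex H = Σ Path (λ p → length p ℕ.< H)

path : ∀ {H} → Vertex H → Path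
path = proj₁

depth : Path → ℕ
depth = length

-- value of a path read as a binary number (most significant bit first);
-- on a fixed level this is the position of the vertex in preorder
-- (left-to-right order of the level).
bit : Bool → ℕ
bit false = 0
bit true  = 1

val : Path → ℕ
val []       = 0
val (b ∷ bs) = bit b ℕ.* 2 ^ length bs ℕ.+ val bs

LeftNb : Path → Path → Set
LeftNb u v = length u ≡ length v × suc (val u) ≡ val v

InSub : Path → Path → Set
InSub u v = ∃[ s ] u ≡ v ++ s

data R : Path → Path → Set where
  treeEdge : ∀ v b → R v (v ++ [ b ])
  e1 : ∀ v u → InSub u v → R v u
  e2 : ∀ v u w → (LeftNb u v ⊎ LeftNb v u) → InSub w u → R v w
  e3 : ∀ v q b p w → v ≡ q ++ [ b ] → LeftNb p q → InSub w p → R v w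

Edge : ∀ {H} → Vertex H → Vertex H → Set
Edge u v = path u ≢ path v × (R (path u) (path v) ⊎ R (path v) (path u))

-- preorder index of a path inside a complete binary tree with h levels
pre : ℕ → Path → ℕ
pre _       []           = 0
pre zero    (_ ∷ _)      = 0
pre (suc h) (false ∷ bs) = suc (pre h bs)
pre (suc h) (true ∷ bs)  = 2 ^ h ℕ.+ pre h bs

xN : ∀ {H} → Vertex H → ℕ
xN {H} v = pre H (path v)

xQ : ∀ {H} → Vertex H → ℚ
xQ v = (+ xN v) / 1

-- u is visited before v in the BFS from the root that visits the right
-- child before the left child: smaller depth, or same depth and further
-- right in preorder.
BFSBefore : Path → Path → Set
BFSBefore u v = depth u ℕ.< depth v ⊎ (depth u ≡ depth v × val v ℕ.< val u)

YOrder : ∀ H → (Vertex H → ℚ) → Set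
YOrder H y = ∀ (u v : Vertex H) → BFSBefore (path u) (path v) → y v < y u

-- w lies strictly above the line through u and v (x u < x v)
AboveLine : ∀ {H} → (Vertex H → ℚ) → Vertex H → Vertex H → Vertex H → Set
AboveLine y u v w =
  (y v - y u) * (xQ w - xQ u) < (y w - y u) * (xQ v - xQ u)

AboveLines : ∀ H → (Vertex H → ℚ) → Set
AboveLines H y = ∀ (u v w : Vertex H) → xN u ℕ.< xN v →
  y u < y w → y v < y w → AboveLine y u v w

Cross : ∀ {H} → (Vertex H → ℚ) → Vertex H → Vertex H → Vertex H → Vertex H → Set
Cross y a b c d = ∃[ s ] ∃[ t ]
  (0ℚ < s × s < 1ℚ × 0ℚ < t × t < 1ℚ ×
   xQ a + s * (xQ b - xQ a) ≡ xQ c + t * (xQ d - xQ c) ×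
   y a + s * (y b - y a) ≡ y c + t * (y d - y c))

-- Only the y-coordinate property AboveLines is needed: since a lies above the
-- lines bc and bd, and b lies on the same side of c and d, the points c and d
-- lie strictly on one side of the line ab.  The orientation test against that
-- line is affine along the segment cd, so it has the same strict sign at every
-- interior point of cd, whereas it vanishes at every point of the line ab;
-- hence the two segments cannot meet.
module Submission where

open import Defs
open import Data.Nat using (ℕ; _≤_)
open import Data.Product using (_×_; _,_)
open import Data.Sum using (_⊎_; inj₁; inj₂)
open import Data.Rational using (ℚ; _<_; _+_; _*_; _-_; -_; 0ℚ; 1ℚ; positive)
import Data.Rational.Properties as ℚ
open import Data.Rational.Solver using (module +-*-Solver)
open import Relation.Nullary using (¬_)
open import Relation.Binary.PropositionalEquality
  using (_≡_; _≢_; refl; sym; trans; cong; cong₂; subst; module ≡-Reasoning)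

open +-*-Solver

0<p*q : ∀ {p q} → 0ℚ < p → 0ℚ < q → 0ℚ < p * q
0<p*q {p} {q} 0<p 0<q =
  ℚ.positive⁻¹ (p * q) {{ℚ.pos*pos⇒pos p {{positive 0<p}} q {{positive 0<q}}}}

0<p+q : ∀ {p q} → 0ℚ < p → 0ℚ < q → 0ℚ < p + q
0<p+q {p} {q} 0<p 0<q = subst (_< p + q) (ℚ.+-identityˡ 0ℚ) (ℚ.+-mono-< 0<p 0<q)

p<q⇒0<q-p : ∀ {p q} → p < q → 0ℚ < q - p
p<q⇒0<q-p {p} {q} p<q = subst (_< q - p) (ℚ.+-inverseʳ p) (ℚ.+-monoˡ-< (- p) p<q)

convex-combination-pos : ∀ {t u v} → 0ℚ < t → t < 1ℚ → 0ℚ < u → 0ℚ < v →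
  0ℚ < (1ℚ - t) * u + t * v
convex-combination-pos 0<t t<1 0<u 0<v =
  0<p+q (0<p*q (p<q⇒0<q-p t<1) 0<u) (0<p*q 0<t 0<v)

Point : Set
Point = ℚ × ℚ

lerp : ℚ → Point → Point → Point
lerp t (px , py) (qx , qy) = px + t * (qx - px) , py + t * (qy - py)

-- Twice the signed area of the triangle pqr: positive iff r lies to the left
-- of the directed line from p to q.  The factors are arranged so that
-- AboveLine is literally a comparison of the two products.
orient : Point → Point → Point → ℚ
orient (px , py) (qx , qy) (rx , ry) = (ry - py) * (qx - px) - (qy - py) * (rx - px)

orient-cyclic : ∀ p q r → orient p q r ≡ orient q r p
orient-cyclic (px , py) (qx , qy) (rx , ry) =
  solve 6 (λ px py qx qy rx ry →
      (ry :- py) :* (qx :- px) :- (qy :- py) :* (rx :- px)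
    := (py :- qy) :* (rx :- qx) :- (ry :- qy) :* (px :- qx))
    refl px py qx qy rx ry

orient-lerp : ∀ p q t c d →
  orient p q (lerp t c d) ≡ (1ℚ - t) * orient p q c + t * orient p q d
orient-lerp (px , py) (qx , qy) t (cx , cy) (dx , dy) =
  solve 9 (λ px py qx qy t cx cy dx dy →
      ((cy :+ t :* (dy :- cy)) :- py) :* (qx :- px) :- (qy :- py) :* ((cx :+ t :* (dx :- cx)) :- px)
    := (con 1ℚ :- t) :* ((cy :- py) :* (qx :- px) :- (qy :- py) :* (cx :- px))
       :+ t :* ((dy :- py) :* (qx :- px) :- (qy :- py) :* (dx :- px)))
    refl px py qx qy t cx cy dx dy

orient-lerp-self : ∀ p q s → orient p q (lerp s p q) ≡ 0ℚ
orient-lerp-self (px , py) (qx , qy) s =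
  solve 5 (λ px py qx qy s →
      ((py :+ s :* (qy :- py)) :- py) :* (qx :- px) :- (qy :- py) :* ((px :+ s :* (qx :- px)) :- px)
    := con 0ℚ)
    refl px py qx qy s

lerp-flip : ∀ s p q → lerp (1ℚ - s) q p ≡ lerp s p q
lerp-flip s (px , py) (qx , qy) = cong₂ _,_ (flip px qx) (flip py qy)
  where
  flip : ∀ u v → v + (1ℚ - s) * (u - v) ≡ u + s * (v - u)
  flip u v = solve 3 (λ s u v → v :+ (con 1ℚ :- s) :* (u :- v) := u :+ s :* (v :- u)) refl s u v

open-segment-misses-line : ∀ p q c d s t → 0ℚ < orient p q c → 0ℚ < orient p q d →
  0ℚ < t → t < 1ℚ → lerp s p q ≢ lerp t c d
open-segment-misses-line p q c d s t 0<c 0<d 0<t t<1 meet =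
  ℚ.<-irrefl on-line (convex-combination-pos 0<t t<1 0<c 0<d)
  where
  open ≡-Reasoning
  on-line : 0ℚ ≡ (1ℚ - t) * orient p q c + t * orient p q d
  on-line = begin
    0ℚ                                              ≡⟨ orient-lerp-self p q s ⟨
    orient p q (lerp s p q)                         ≡⟨ cong (orient p q) meet ⟩
    orient p q (lerp t c d)                         ≡⟨ orient-lerp p q t c d ⟩
    (1ℚ - t) * orient p q c + t * orient p q d      ∎

point : ∀ {H} → (Vertex H → ℚ) → Vertex H → Point
point y v = xQ v , y v

aboveLine⇒0<orient : ∀ {H} (y : Vertex H → ℚ) (u v w : Vertex H) →
  AboveLine y u v w → 0ℚ < orient (point y u) (point y v) (point y w)
aboveLine⇒0<orient _ _ _ _ = p<q⇒0<q-p

mainTheorem8 : (H : ℕ) → 2 ≤ H → (y : Vertex H → ℚ) → YOrder H y → AboveLines H y →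
    (a b c d : Vertex H) → Edge a b → Edge c d →
    y b < y a → y c < y a → y d < y a →
    ((xN b Data.Nat.< xN c × xN b Data.Nat.< xN d) ⊎ (xN c Data.Nat.< xN b × xN d Data.Nat.< xN b)) →
    ¬ Cross y a b c d
mainTheorem8 H _ y _ above a b c d _ _ yb<ya yc<ya yd<ya
  (inj₁ (xb<xc , xb<xd)) (s , t , _ , _ , 0<t , t<1 , ex , ey) =
  open-segment-misses-line A B C D s t
    (left-of-ab c (above b c a xb<xc yb<ya yc<ya))
    (left-of-ab d (above b d a xb<xd yb<ya yd<ya)) 0<t t<1 (cong₂ _,_ ex ey)
  where
  A B C D : Point
  A = point y a ; B = point y b ; C = point y c ; D = point y d
  left-of-ab : ∀ v → AboveLine y b v a → 0ℚ < orient A B (point y v)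
  left-of-ab v above-bv =
    subst (0ℚ <_) (sym (orient-cyclic A B (point y v))) (aboveLine⇒0<orient y b v a above-bv)
mainTheorem8 H _ y _ above a b c d _ _ yb<ya yc<ya yd<ya
  (inj₂ (xc<xb , xd<xb)) (s , t , _ , _ , 0<t , t<1 , ex , ey) =
  open-segment-misses-line B A C D (1ℚ - s) t
    (left-of-ba c (above c b a xc<xb yc<ya yb<ya))
    (left-of-ba d (above d b a xd<xb yd<ya yb<ya)) 0<t t<1
    (trans (lerp-flip s A B) (cong₂ _,_ ex ey))
  where
  A B C D : Point
  A = point y a ; B = point y b ; C = point y c ; D = point y d
  left-of-ba : ∀ v → AboveLine y v b a → 0ℚ < orient B A (point y v)
  left-of-ba v above-vb =
    subst (0ℚ <_) (orient-cyclic (point y v) B A) (aboveLine⇒0<orient y v b a above-vb)
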